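{- Let $w=w_1\cdots w_n\in S_n$ contain the pattern $132$, i.e. there exist indices $i<t<j$ with $w_i<w_j<w_t$. Let $p=\max\{t : \exists\, i<t<j \text{ with } w_i<w_j<w_t\}$ and $q=\max\{j : j>p,\ w_j<w_p,\ \exists\, i<p \text{ with } w_i<w_j\}$. Then $q$ is the index of the largest number among the entries following $w_p$ (i.e. among $w_{p+1},\ldots,w_n$) that are less than $w_p$; that is, $w_q=\max\{w_j: j>p,\ w_j<w_p\}$.
   Context: Permutations are in one-line notation $w=w_1\cdots w_n$. -}

module Defs where

open import Data.Nat using (ℕ)
open import Data.Fin using (Fin; _<_; _≤_)
open import Data.Fin.Permutation using (Permutation′; _⟨$⟩ʳ_)
open import Data.Product using (Σ; _×_; ∃; ∃-syntax)

-- Positions are 0-based (Fin n); w_k is  w ⟨$⟩ʳ k ; values also in Fin n.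

Occ132 : {n : ℕ} → Permutation′ n → Fin n → Fin n → Fin n → Set
Occ132 w i t j = (i < t) × (t < j) × ((w ⟨$⟩ʳ i) < (w ⟨$⟩ʳ j)) × ((w ⟨$⟩ʳ j) < (w ⟨$⟩ʳ t))

Contains132 : {n : ℕ} → Permutation′ n → Set
Contains132 w = ∃[ i ] ∃[ t ] ∃[ j ] Occ132 w i t j

PSet : {n : ℕ} → Permutation′ n → Fin n → Set
PSet w t = ∃[ i ] ∃[ j ] Occ132 w i t j

QSet : {n : ℕ} → Permutation′ n → Fin n → Fin n → Set
QSet w p j = (p < j) × ((w ⟨$⟩ʳ j) < (w ⟨$⟩ʳ p)) × (∃[ i ] ((i < p) × ((w ⟨$⟩ʳ i) < (w ⟨$⟩ʳ j))))

IsMax : {n : ℕ} → (Fin n → Set) → Fin n → Set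
IsMax P m = P m × (∀ k → P k → k ≤ m)

BelowAfter : {n : ℕ} → Permutation′ n → Fin n → Fin n → Set
BelowAfter w p j = (p < j) × ((w ⟨$⟩ʳ j) < (w ⟨$⟩ʳ p))

IsMaxValueBelowAfter : {n : ℕ} → Permutation′ n → Fin n → Fin n → Set
IsMaxValueBelowAfter w p q = BelowAfter w p q × (∀ j → BelowAfter w p j → (w ⟨$⟩ʳ j) ≤ (w ⟨$⟩ʳ q))

module Submission where

open import Defs
open import Data.Nat using (ℕ)
import Data.Nat.Properties as ℕ
open import Data.Fin using (Fin; _<_)
open import Data.Fin.Permutation using (Permutation′; _⟨$⟩ʳ_)
open import Data.Fin.Properties using (<-trans; <-irrefl; ≤∧≢⇒<)
open import Data.Product using (_,_)
open import Data.Empty using (⊥)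
open import Relation.Binary.PropositionalEquality using (refl)

-- If some j with p < j and w_q < w_j < w_p existed, it would lie in the q-set, so j < q by
-- maximality of q; but then (i, j, q) is a 132 occurrence whose middle position j exceeds p,
-- against the maximality of p.

module _ {n : ℕ} (w : Permutation′ n) where

  QSet-upward : ∀ {p q j} → QSet w p q → BelowAfter w p j →
                (w ⟨$⟩ʳ q) < (w ⟨$⟩ʳ j) → QSet w p j
  QSet-upward (_ , _ , i , i<p , wi<wq) (p<j , wj<wp) wq<wj =
    p<j , wj<wp , i , i<p , <-trans wi<wq wq<wj

  QSet-between⇒PSet : ∀ {p q j} → QSet w p q → p < j → j < q →
                      (w ⟨$⟩ʳ q) < (w ⟨$⟩ʳ j) → PSet w j
  QSet-between⇒PSet (_ , _ , i , i<p , wi<wq) p<j j<q wq<wj =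
    i , _ , <-trans i<p p<j , j<q , wi<wq , wq<wj

lemma4p1 : (n : ℕ) (w : Permutation′ n) → Contains132 w → (p q : Fin n) → IsMax (PSet w) p → IsMax (QSet w p) q → IsMaxValueBelowAfter w p q
lemma4p1 n w _ p q (_ , p-max) (q∈Q@(p<q , wq<wp , _) , q-max) =
  (p<q , wq<wp) , λ j j∈B → ℕ.≮⇒≥ (no-larger j j∈B)
  where
  no-larger : ∀ j → BelowAfter w p j → (w ⟨$⟩ʳ q) < (w ⟨$⟩ʳ j) → ⊥
  no-larger j j∈B@(p<j , _) wq<wj = ℕ.<⇒≱ p<j (p-max j (QSet-between⇒PSet w q∈Q p<j j<q wq<wj))
    where
    j<q : j < q
    j<q = ≤∧≢⇒< (q-max j (QSet-upward w q∈Q j∈B wq<wj)) λ { refl → <-irrefl refl wq<wj }
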